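{- Let $(a,b,c,d,e,f)$ be any one of the following fifteen 6-tuples: $(1,-1,1,-1,-2,1)$, $(1,-1,1,-2,-1,1)$, $(1,1,-1,-2,1,1)$, $(1,1,2,-2,3,1)$, $(1,-1,3,2,-2,1)$, $(1,-1,3,-2,2,1)$, $(2,-1,-1,1,-6,1)$, $(2,-1,-1,-6,1,1)$, $(1,1,1,-6,-1,2)$, $(2,1,2,-2,5,1)$, $(1,-1,5,-2,2,2)$, $(1,-2,5,2,-2,1)$, $(1,-1,7,-7,2,4)$, $(1,-4,7,2,-7,1)$, $(1,4,-7,2,7,1)$. Then for every non-negative integer $n$ and all integers $m$ and $p$, \[ \sum_{j=0}^n\binom{n}{j}a^jb^{n-j}P_{(m+d)n+p+(c-d)j}=f^nP_{(m+e)n+p}. \]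
   Context: The Padovan numbers $P_n$ are defined for all integers $n$ by $P_0=P_1=P_2=1$ and $P_n=P_{n-2}+P_{n-3}$ for all integers $n$ (extended to negative indices via $P_n=P_{n+3}-P_{n+1}$). The listed tuples are exactly those for which $a\theta^{m+c}+b\theta^{m+d}=f\theta^{m+e}$ holds for every root $\theta$ of $x^3-x-1$ and every integer $m$. -}

module Defs where

open import Data.Nat using (ℕ; zero; suc)
open import Data.Integer using (ℤ; +_; -[1+_]; _+_; _-_; _*_; -_)
open import Data.Integer using () renaming (_^_ to _^ℤ_) public
open import Data.List using (List; []; _∷_)
open import Data.Product using (_×_; _,_)

Pnat : ℕ → ℤ
Pnat 0 = + 1
Pnat 1 = + 1
Pnat 2 = + 1
Pnat (suc (suc (suc n))) = Pnat (suc n) + Pnat n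

-- Pneg k = P_{-k}, obtained from P_n = P_{n+3} - P_{n+1}:
-- P_{-(k+3)} = P_{-k} - P_{-(k+2)}; with P_0 = 1, P_{-1} = P_2 - P_0 = 0, P_{-2} = P_1 - P_{-1} = 1
Pneg : ℕ → ℤ
Pneg 0 = + 1
Pneg 1 = + 0
Pneg 2 = + 1
Pneg (suc (suc (suc k))) = Pneg k - Pneg (suc (suc k))

P : ℤ → ℤ
P (+ n) = Pnat n
P -[1+ k ] = Pneg (suc k)

Tuple : Set
Tuple = ℤ × ℤ × ℤ × ℤ × ℤ × ℤ

tuples : List Tuple
tuples =
    (+ 1 , - + 1 , + 1 , - + 1 , - + 2 , + 1)
  ∷ (+ 1 , - + 1 , + 1 , - + 2 , - + 1 , + 1)
  ∷ (+ 1 , + 1 , - + 1 , - + 2 , + 1 , + 1)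
  ∷ (+ 1 , + 1 , + 2 , - + 2 , + 3 , + 1)
  ∷ (+ 1 , - + 1 , + 3 , + 2 , - + 2 , + 1)
  ∷ (+ 1 , - + 1 , + 3 , - + 2 , + 2 , + 1)
  ∷ (+ 2 , - + 1 , - + 1 , + 1 , - + 6 , + 1)
  ∷ (+ 2 , - + 1 , - + 1 , - + 6 , + 1 , + 1)
  ∷ (+ 1 , + 1 , + 1 , - + 6 , - + 1 , + 2)
  ∷ (+ 2 , + 1 , + 2 , - + 2 , + 5 , + 1)
  ∷ (+ 1 , - + 1 , + 5 , - + 2 , + 2 , + 2)
  ∷ (+ 1 , - + 2 , + 5 , + 2 , - + 2 , + 1)
  ∷ (+ 1 , - + 1 , + 7 , - + 7 , + 2 , + 4)
  ∷ (+ 1 , - + 4 , + 7 , + 2 , - + 7 , + 1)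
  ∷ (+ 1 , + 4 , - + 7 , + 2 , + 7 , + 1)
  ∷ []

sumTo : ℕ → (ℕ → ℤ) → ℤ
sumTo zero f = f zero
sumTo (suc n) f = sumTo n f + f (suc n)

module Submission where

-- Let θ be a root of x³ − x − 1.  Every power θᵗ (t ∈ ℤ) is an
-- integer combination u + vθ + wθ², and for any sequence Q on ℤ obeying the
-- Padovan recurrence Q(k+3) = Q(k+1) + Q(k) the same coordinates express the
-- shift:  Q(k+t) = u·Q(k) + v·Q(k+1) + w·Q(k+2).  Hence an identity
-- a θᶜ + b θᵈ = f θᵉ between coordinate vectors, which for each listed tuple is
-- checked by computation, yields the three-term relation
--   a·Q(k+c) + b·Q(k+d) = f·Q(k+e)   for every k ∈ ℤ.            (★)
-- The binomial identity then holds for ANY sequence satisfying (★): induct on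
-- n, split the binomial sum with Pascal's rule into an a-part and a b-part,
-- apply the induction hypothesis at the shifted starting points k+c and k+d,
-- and recombine with (★).

open import Defs
open import Data.Nat using (ℕ; _∸_)
open import Data.Nat.Combinatorics using (_C_)
open import Data.Integer using (ℤ; +_; _+_; _-_; _*_)
open import Data.List.Membership.Propositional using (_∈_)
open import Relation.Binary.PropositionalEquality using (_≡_)
open import Data.Product using (_,_)

open import Data.Nat as ℕ using (zero; suc)
import Data.Nat.Properties as ℕ
open import Data.Nat.Combinatorics using (k>n⇒nCk≡0; nCk+nC[k+1]≡[n+1]C[k+1])
open import Data.Integer using (-[1+_])
open import Data.Product using (_×_)
open import Data.List.Relation.Unary.All using (All; []; _∷_)
import Data.List.Relation.Unary.All as All
open import Relation.Binary.PropositionalEquality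
  using (refl; sym; trans; cong; cong₂; module ≡-Reasoning)
open import Data.Integer.Tactic.RingSolver using (solve-∀)

sumTo-cong : ∀ n {g h : ℕ → ℤ} → (∀ j → j ℕ.≤ n → g j ≡ h j) → sumTo n g ≡ sumTo n h
sumTo-cong zero    eq = eq 0 ℕ.z≤n
sumTo-cong (suc n) eq =
  cong₂ _+_ (sumTo-cong n (λ j j≤n → eq j (ℕ.m≤n⇒m≤1+n j≤n))) (eq (suc n) ℕ.≤-refl)

sumTo-peel : ∀ n (g : ℕ → ℤ) → sumTo (suc n) g ≡ g 0 + sumTo n (λ j → g (suc j))
sumTo-peel zero    g = refl
sumTo-peel (suc n) g =
  trans (cong (_+ g (suc (suc n))) (sumTo-peel n g)) (+-assoc (g 0) _ _)
  where
  +-assoc : ∀ (x y z : ℤ) → x + y + z ≡ x + (y + z)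
  +-assoc = solve-∀

sumTo-+ : ∀ n (g h : ℕ → ℤ) → sumTo n (λ j → g j + h j) ≡ sumTo n g + sumTo n h
sumTo-+ zero    g h = refl
sumTo-+ (suc n) g h =
  trans (cong (_+ (g (suc n) + h (suc n))) (sumTo-+ n g h)) (interchange (sumTo n g) (sumTo n h) (g (suc n)) (h (suc n)))
  where
  interchange : ∀ (x y z w : ℤ) → x + y + (z + w) ≡ x + z + (y + w)
  interchange = solve-∀

sumTo-scale : ∀ n (x : ℤ) (g : ℕ → ℤ) → sumTo n (λ j → x * g j) ≡ x * sumTo n g
sumTo-scale zero    x g = refl
sumTo-scale (suc n) x g =
  trans (cong (_+ (x * g (suc n))) (sumTo-scale n x g)) (distrib x _ _)
  where
  distrib : ∀ (x y z : ℤ) → x * y + x * z ≡ x * (y + z)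
  distrib = solve-∀

binomialTerm : ℕ → ℤ → ℤ → (ℕ → ℤ) → ℕ → ℤ
binomialTerm n x y G j = + (n C j) * x ^ℤ j * y ^ℤ (n ∸ j) * G j

binomialSum : ℕ → ℤ → ℤ → (ℕ → ℤ) → ℤ
binomialSum n x y G = sumTo n (binomialTerm n x y G)

binomialSum-cong : ∀ n x y {G H : ℕ → ℤ} → (∀ j → G j ≡ H j) →
  binomialSum n x y G ≡ binomialSum n x y H
binomialSum-cong n x y eq =
  sumTo-cong n (λ j _ → cong (λ z → + (n C j) * x ^ℤ j * y ^ℤ (n ∸ j) * z) (eq j))

pascal-term : ∀ n x y (G : ℕ → ℤ) j →
  binomialTerm (suc n) x y G (suc j)
    ≡ x * binomialTerm n x y (λ i → G (suc i)) j
      + + (n C suc j) * x ^ℤ suc j * y ^ℤ (n ∸ j) * G (suc j)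
pascal-term n x y G j =
  trans (cong (λ z → + z * x ^ℤ suc j * y ^ℤ (n ∸ j) * G (suc j))
              (sym (nCk+nC[k+1]≡[n+1]C[k+1] n j)))
        (split (+ (n C j)) (+ (n C suc j)) (x ^ℤ j) x (y ^ℤ (n ∸ j)) (G (suc j)))
  where
  split : ∀ (c₁ c₂ xʲ x yʲ g : ℤ) →
    (c₁ + c₂) * (x * xʲ) * yʲ * g ≡ x * (c₁ * xʲ * yʲ * g) + c₂ * (x * xʲ) * yʲ * g
  split = solve-∀

-- The remainders, together with the j = 0 term, form y times the n-th sum:
-- they are the terms of Σ_{j=0}^{n+1} C(n,j) xʲ yⁿ⁺¹⁻ʲ G j, whose last term
-- vanishes since C(n,n+1) = 0.
pascal-remainder : ∀ n x y (G : ℕ → ℤ) →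
  binomialTerm (suc n) x y G 0
    + sumTo n (λ j → + (n C suc j) * x ^ℤ suc j * y ^ℤ (n ∸ j) * G (suc j))
    ≡ y * binomialSum n x y G
pascal-remainder n x y G = begin
    binomialTerm (suc n) x y G 0 + sumTo n (λ j → h (suc j))
  ≡⟨ sym (sumTo-peel n h) ⟩
    sumTo n h + h (suc n)
  ≡⟨ cong (λ c → sumTo n h + + c * x ^ℤ suc n * y ^ℤ (n ∸ n) * G (suc n))
          (k>n⇒nCk≡0 (ℕ.n<1+n n)) ⟩
    sumTo n h + + 0 * x ^ℤ suc n * y ^ℤ (n ∸ n) * G (suc n)
  ≡⟨ drop-zero (sumTo n h) (x ^ℤ suc n) (y ^ℤ (n ∸ n)) (G (suc n)) ⟩
    sumTo n h
  ≡⟨ sumTo-cong n absorb-y ⟩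
    sumTo n (λ j → y * binomialTerm n x y G j)
  ≡⟨ sumTo-scale n y (binomialTerm n x y G) ⟩
    y * binomialSum n x y G
  ∎
  where
  open ≡-Reasoning
  h : ℕ → ℤ
  h j = + (n C j) * x ^ℤ j * y ^ℤ (suc n ∸ j) * G j
  drop-zero : ∀ (s xⁿ yⁿ g : ℤ) → s + + 0 * xⁿ * yⁿ * g ≡ s
  drop-zero = solve-∀
  factor : ∀ (c xʲ y yʲ g : ℤ) → c * xʲ * (y * yʲ) * g ≡ y * (c * xʲ * yʲ * g)
  factor = solve-∀
  absorb-y : ∀ j → j ℕ.≤ n → h j ≡ y * binomialTerm n x y G j
  absorb-y j j≤n rewrite ℕ.+-∸-assoc 1 j≤n =
    factor (+ (n C j)) (x ^ℤ j) y (y ^ℤ (n ∸ j)) (G j)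

binomialSum-pascal : ∀ n x y (G : ℕ → ℤ) →
  binomialSum (suc n) x y G
    ≡ x * binomialSum n x y (λ j → G (suc j)) + y * binomialSum n x y G
binomialSum-pascal n x y G = begin
    binomialSum (suc n) x y G
  ≡⟨ sumTo-peel n _ ⟩
    t₀ + sumTo n (λ j → binomialTerm (suc n) x y G (suc j))
  ≡⟨ cong (_+_ t₀) (sumTo-cong n (λ j _ → pascal-term n x y G j)) ⟩
    t₀ + sumTo n (λ j → x * A j + R j)
  ≡⟨ cong (_+_ t₀) (sumTo-+ n _ R) ⟩
    t₀ + (sumTo n (λ j → x * A j) + sumTo n R)
  ≡⟨ cong (λ s → t₀ + (s + sumTo n R)) (sumTo-scale n x A) ⟩
    t₀ + (x * sumTo n A + sumTo n R)
  ≡⟨ rearrange t₀ (x * sumTo n A) (sumTo n R) ⟩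
    x * sumTo n A + (t₀ + sumTo n R)
  ≡⟨ cong (_+_ (x * sumTo n A)) (pascal-remainder n x y G) ⟩
    x * binomialSum n x y (λ j → G (suc j)) + y * binomialSum n x y G
  ∎
  where
  open ≡-Reasoning
  t₀ : ℤ
  t₀ = binomialTerm (suc n) x y G 0
  A R : ℕ → ℤ
  A = binomialTerm n x y (λ j → G (suc j))
  R j = + (n C suc j) * x ^ℤ suc j * y ^ℤ (n ∸ j) * G (suc j)
  rearrange : ∀ (t s r : ℤ) → t + (s + r) ≡ s + (t + r)
  rearrange = solve-∀

-- Induction on n, with the hypothesis used at the starting points k+c, k+d.
module BinomialLemma (Q : ℤ → ℤ) (a b c d e f : ℤ)
  (three-term : ∀ k → a * Q (k + c) + b * Q (k + d) ≡ f * Q (k + e)) where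

  binomial : ∀ n k →
    binomialSum n a b (λ j → Q (k + d * + n + (c - d) * + j)) ≡ f ^ℤ n * Q (k + e * + n)
  binomial zero k =
    trans (unit-coefficient _) (cong (λ i → + 1 * Q i) (no-shift k d c e))
    where
    unit-coefficient : ∀ (q : ℤ) → + 1 * + 1 * + 1 * q ≡ + 1 * q
    unit-coefficient = solve-∀
    no-shift : ∀ (k d c e : ℤ) → k + d * + 0 + (c - d) * + 0 ≡ k + e * + 0
    no-shift = solve-∀
  binomial (suc n) k = begin
      binomialSum (suc n) a b (λ j → Q (k + d * + suc n + (c - d) * + j))
    ≡⟨ binomialSum-pascal n a b _ ⟩
      a * binomialSum n a b (λ j → Q (k + d * + suc n + (c - d) * + suc j))
        + b * binomialSum n a b (λ j → Q (k + d * + suc n + (c - d) * + j))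
    ≡⟨ cong₂ (λ u v → a * u + b * v)
         (binomialSum-cong n a b (λ j → cong Q (index-a k c d (+ n) (+ j))))
         (binomialSum-cong n a b (λ j → cong Q (index-b k c d (+ n) (+ j)))) ⟩
      a * binomialSum n a b (λ j → Q (k + c + d * + n + (c - d) * + j))
        + b * binomialSum n a b (λ j → Q (k + d + d * + n + (c - d) * + j))
    ≡⟨ cong₂ (λ u v → a * u + b * v) (binomial n (k + c)) (binomial n (k + d)) ⟩
      a * (f ^ℤ n * Q (k + c + e * + n)) + b * (f ^ℤ n * Q (k + d + e * + n))
    ≡⟨ cong₂ (λ u v → a * (f ^ℤ n * Q u) + b * (f ^ℤ n * Q v))
         (commute-shift k c e (+ n)) (commute-shift k d e (+ n)) ⟩
      a * (f ^ℤ n * Q (k' + c)) + b * (f ^ℤ n * Q (k' + d))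
    ≡⟨ factor-fⁿ a b (f ^ℤ n) (Q (k' + c)) (Q (k' + d)) ⟩
      f ^ℤ n * (a * Q (k' + c) + b * Q (k' + d))
    ≡⟨ cong (f ^ℤ n *_) (three-term k') ⟩
      f ^ℤ n * (f * Q (k' + e))
    ≡⟨ collect f (f ^ℤ n) (Q (k' + e)) ⟩
      f * f ^ℤ n * Q (k' + e)
    ≡⟨ cong (λ i → f * f ^ℤ n * Q i) (absorb-e k e (+ n)) ⟩
      f ^ℤ suc n * Q (k + e * + suc n)
    ∎
    where
    open ≡-Reasoning
    k' : ℤ
    k' = k + e * + n
    index-a : ∀ (k c d N J : ℤ) → k + d * (+ 1 + N) + (c - d) * (+ 1 + J) ≡ k + c + d * N + (c - d) * J
    index-a = solve-∀
    index-b : ∀ (k c d N J : ℤ) → k + d * (+ 1 + N) + (c - d) * J ≡ k + d + d * N + (c - d) * J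
    index-b = solve-∀
    commute-shift : ∀ (k s e N : ℤ) → k + s + e * N ≡ k + e * N + s
    commute-shift = solve-∀
    factor-fⁿ : ∀ (a b φ x y : ℤ) → a * (φ * x) + b * (φ * y) ≡ φ * (a * x + b * y)
    factor-fⁿ = solve-∀
    collect : ∀ (f φ z : ℤ) → φ * (f * z) ≡ f * φ * z
    collect = solve-∀
    absorb-e : ∀ (k e N : ℤ) → k + e * N + e ≡ k + e * (+ 1 + N)
    absorb-e = solve-∀

-- Coordinates in ℤ[θ]/(θ³ − θ − 1) with respect to the basis 1, θ, θ²:
-- (u , v , w) stands for u + vθ + wθ².

Coord : Set
Coord = ℤ × ℤ × ℤ

-- Multiplication by θ, using θ³ = θ + 1.
mulθ : Coord → Coord
mulθ (u , v , w) = (w , u + w , v)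

-- Multiplication by θ⁻¹ = θ² − 1.
divθ : Coord → Coord
divθ (u , v , w) = (v - u , w , u)

θ^ : ℤ → Coord
θ^ (+ zero)      = (+ 1 , + 0 , + 0)
θ^ (+ suc n)     = mulθ (θ^ (+ n))
θ^ -[1+ zero ]   = divθ (θ^ (+ 0))
θ^ -[1+ suc n ]  = divθ (θ^ -[1+ n ])

combine : ℤ → Coord → ℤ → Coord → Coord
combine α (u , v , w) β (u' , v' , w') = (α * u + β * u' , α * v + β * v' , α * w + β * w')

scale : ℤ → Coord → Coord
scale φ (u , v , w) = (φ * u , φ * v , φ * w)

-- The coordinate calculus for an arbitrary sequence Q satisfying the Padovan
-- recurrence: reading u + vθ + wθ² at k as u·Q k + v·Q(k+1) + w·Q(k+2), the
-- coordinates of θᵗ compute the shift by t.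
module PadovanShift (Q : ℤ → ℤ) (recurrence : ∀ k → Q (k + + 3) ≡ Q (k + + 1) + Q k) where

  evalAt : Coord → ℤ → ℤ
  evalAt (u , v , w) k = u * Q k + v * Q (k + + 1) + w * Q (k + + 2)

  evalAt-mulθ : ∀ s k → evalAt (mulθ s) k ≡ evalAt s (k + + 1)
  evalAt-mulθ (u , v , w) k = begin
      w * Q k + (u + w) * Q (k + + 1) + v * Q (k + + 2)
    ≡⟨ reduce u v w (Q k) (Q (k + + 1)) (Q (k + + 2)) ⟩
      u * Q (k + + 1) + v * Q (k + + 2) + w * (Q (k + + 1) + Q k)
    ≡⟨ cong₂ (λ x y → u * Q (k + + 1) + v * x + w * y)
         (cong Q (sym (step₁ k))) (sym (trans (cong Q (step₂ k)) (recurrence k))) ⟩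
      evalAt (u , v , w) (k + + 1)
    ∎
    where
    open ≡-Reasoning
    step₁ : ∀ (k : ℤ) → k + + 1 + + 1 ≡ k + + 2
    step₁ = solve-∀
    step₂ : ∀ (k : ℤ) → k + + 1 + + 2 ≡ k + + 3
    step₂ = solve-∀
    reduce : ∀ (u v w q₀ q₁ q₂ : ℤ) →
      w * q₀ + (u + w) * q₁ + v * q₂ ≡ u * q₁ + v * q₂ + w * (q₁ + q₀)
    reduce = solve-∀

  evalAt-divθ : ∀ s k → evalAt (divθ s) k ≡ evalAt s (k - + 1)
  evalAt-divθ (u , v , w) k = begin
      (v - u) * Q k + w * Q (k + + 1) + u * Q (k + + 2)
    ≡⟨ cong (λ z → (v - u) * Q k + w * Q (k + + 1) + u * z) recurrence-back ⟩
      (v - u) * Q k + w * Q (k + + 1) + u * (Q k + Q (k - + 1))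
    ≡⟨ reduce u v w (Q (k - + 1)) (Q k) (Q (k + + 1)) ⟩
      u * Q (k - + 1) + v * Q k + w * Q (k + + 1)
    ≡⟨ cong₂ (λ x y → u * Q (k - + 1) + v * Q x + w * Q y) (sym (back₁ k)) (sym (back₂ k)) ⟩
      evalAt (u , v , w) (k - + 1)
    ∎
    where
    open ≡-Reasoning
    back₁ : ∀ (k : ℤ) → k - + 1 + + 1 ≡ k
    back₁ = solve-∀
    back₂ : ∀ (k : ℤ) → k - + 1 + + 2 ≡ k + + 1
    back₂ = solve-∀
    back₃ : ∀ (k : ℤ) → k + + 2 ≡ k - + 1 + + 3
    back₃ = solve-∀
    recurrence-back : Q (k + + 2) ≡ Q k + Q (k - + 1)
    recurrence-back = trans (cong Q (back₃ k))
      (trans (recurrence (k - + 1)) (cong (λ x → Q x + Q (k - + 1)) (back₁ k)))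
    reduce : ∀ (u v w q₋ q₀ q₁ : ℤ) →
      (v - u) * q₀ + w * q₁ + u * (q₀ + q₋) ≡ u * q₋ + v * q₀ + w * q₁
    reduce = solve-∀

  evalAt-one : ∀ k → Q k ≡ evalAt (+ 1 , + 0 , + 0) k
  evalAt-one k = unit (Q k) (Q (k + + 1)) (Q (k + + 2))
    where
    unit : ∀ (q₀ q₁ q₂ : ℤ) → q₀ ≡ + 1 * q₀ + + 0 * q₁ + + 0 * q₂
    unit = solve-∀

  shift : ∀ t k → Q (k + t) ≡ evalAt (θ^ t) k
  shift (+ zero) k = trans (cong Q (+-zero k)) (evalAt-one k)
    where
    +-zero : ∀ (k : ℤ) → k + + 0 ≡ k
    +-zero = solve-∀
  shift (+ suc n) k = begin
      Q (k + + suc n)        ≡⟨ cong Q (forward k (+ n)) ⟩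
      Q (k + + 1 + + n)      ≡⟨ shift (+ n) (k + + 1) ⟩
      evalAt (θ^ (+ n)) (k + + 1) ≡⟨ sym (evalAt-mulθ (θ^ (+ n)) k) ⟩
      evalAt (θ^ (+ suc n)) k ∎
    where
    open ≡-Reasoning
    forward : ∀ (k N : ℤ) → k + (+ 1 + N) ≡ k + + 1 + N
    forward = solve-∀
  shift -[1+ zero ] k =
    trans (evalAt-one (k - + 1)) (sym (evalAt-divθ (θ^ (+ 0)) k))
  shift -[1+ suc n ] k = begin
      Q (k + -[1+ suc n ])          ≡⟨ cong Q (backward k n) ⟩
      Q (k - + 1 + -[1+ n ])        ≡⟨ shift -[1+ n ] (k - + 1) ⟩
      evalAt (θ^ -[1+ n ]) (k - + 1) ≡⟨ sym (evalAt-divθ (θ^ -[1+ n ]) k) ⟩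
      evalAt (θ^ -[1+ suc n ]) k    ∎
    where
    open ≡-Reasoning
    backward : ∀ k n → k + -[1+ suc n ] ≡ k - + 1 + -[1+ n ]
    backward k n = trans (cong (_+_ k) (cong (λ i → -[1+ suc i ]) (sym (ℕ.+-identityʳ n))))
                         (reassociate k -[1+ n ])
      where
      reassociate : ∀ (k N : ℤ) → k + (N + -[1+ 0 ]) ≡ k - + 1 + N
      reassociate = solve-∀

  evalAt-combine : ∀ α s β t k → α * evalAt s k + β * evalAt t k ≡ evalAt (combine α s β t) k
  evalAt-combine α (u , v , w) β (u' , v' , w') k =
    linear α β u v w u' v' w' (Q k) (Q (k + + 1)) (Q (k + + 2))
    where
    linear : ∀ (α β u v w u' v' w' q₀ q₁ q₂ : ℤ) →
      α * (u * q₀ + v * q₁ + w * q₂) + β * (u' * q₀ + v' * q₁ + w' * q₂)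
        ≡ (α * u + β * u') * q₀ + (α * v + β * v') * q₁ + (α * w + β * w') * q₂
    linear = solve-∀

  evalAt-scale : ∀ φ t k → φ * evalAt t k ≡ evalAt (scale φ t) k
  evalAt-scale φ (u , v , w) k = homogeneous φ u v w (Q k) (Q (k + + 1)) (Q (k + + 2))
    where
    homogeneous : ∀ (φ u v w q₀ q₁ q₂ : ℤ) →
      φ * (u * q₀ + v * q₁ + w * q₂) ≡ (φ * u) * q₀ + (φ * v) * q₁ + (φ * w) * q₂
    homogeneous = solve-∀

  three-term : ∀ a b c d e f → combine a (θ^ c) b (θ^ d) ≡ scale f (θ^ e) →
    ∀ k → a * Q (k + c) + b * Q (k + d) ≡ f * Q (k + e)
  three-term a b c d e f θ-identity k = begin
      a * Q (k + c) + b * Q (k + d)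
    ≡⟨ cong₂ (λ x y → a * x + b * y) (shift c k) (shift d k) ⟩
      a * evalAt (θ^ c) k + b * evalAt (θ^ d) k
    ≡⟨ evalAt-combine a (θ^ c) b (θ^ d) k ⟩
      evalAt (combine a (θ^ c) b (θ^ d)) k
    ≡⟨ cong (λ s → evalAt s k) θ-identity ⟩
      evalAt (scale f (θ^ e)) k
    ≡⟨ sym (evalAt-scale f (θ^ e) k) ⟩
      f * evalAt (θ^ e) k
    ≡⟨ cong (f *_) (sym (shift e k)) ⟩
      f * Q (k + e)
    ∎
    where open ≡-Reasoning

padovan-recurrence : ∀ k → P (k + + 3) ≡ P (k + + 1) + P k
padovan-recurrence (+ n) rewrite ℕ.+-comm n 3 | ℕ.+-comm n 1 = refl
padovan-recurrence -[1+ 0 ] = refl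
padovan-recurrence -[1+ 1 ] = refl
padovan-recurrence -[1+ 2 ] = refl
padovan-recurrence -[1+ suc (suc (suc k)) ] =
  difference (Pneg (suc k)) (Pneg (suc (suc (suc k))))
  where
  difference : ∀ (x y : ℤ) → x ≡ y + (x - y)
  difference = solve-∀

Admissible : Tuple → Set
Admissible (a , b , c , d , e , f) = combine a (θ^ c) b (θ^ d) ≡ scale f (θ^ e)

tuples-admissible : All Admissible tuples
tuples-admissible =
  refl ∷ refl ∷ refl ∷ refl ∷ refl ∷ refl ∷ refl ∷ refl ∷
  refl ∷ refl ∷ refl ∷ refl ∷ refl ∷ refl ∷ refl ∷ []

theorem14 : (a b c d e f : ℤ) → (a , b , c , d , e , f) ∈ tuples →
    (n : ℕ) (m p : ℤ) →
    sumTo n (λ j → (+ (n C j)) * (a ^ℤ j) * (b ^ℤ (n ∸ j)) * P ((m + d) * + n + p + (c - d) * + j))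
      ≡ (f ^ℤ n) * P ((m + e) * + n + p)
theorem14 a b c d e f listed n m p = begin
    binomialSum n a b (λ j → P ((m + d) * + n + p + (c - d) * + j))
  ≡⟨ binomialSum-cong n a b (λ j → cong P (split-left m d p c (+ n) (+ j))) ⟩
    binomialSum n a b (λ j → P (m * + n + p + d * + n + (c - d) * + j))
  ≡⟨ binomial n (m * + n + p) ⟩
    f ^ℤ n * P (m * + n + p + e * + n)
  ≡⟨ cong (λ i → f ^ℤ n * P i) (merge-right m e p (+ n)) ⟩
    f ^ℤ n * P ((m + e) * + n + p)
  ∎
  where
  open ≡-Reasoning
  open PadovanShift P padovan-recurrence using (three-term)
  open BinomialLemma P a b c d e f
         (three-term a b c d e f (All.lookup tuples-admissible listed)) using (binomial)
  split-left : ∀ (m d p c N J : ℤ) → (m + d) * N + p + (c - d) * J ≡ m * N + p + d * N + (c - d) * J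
  split-left = solve-∀
  merge-right : ∀ (m e p N : ℤ) → m * N + p + e * N ≡ (m + e) * N + p
  merge-right = solve-∀
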